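{- Let $T_1$ and $T_2$ be two trees, each having at least one edge. Then $$\chi_s'(T_1\Box T_2)\ \ge\ \max\{2\Delta(T_1)+\Delta'(T_2),\ 2\Delta(T_2)+\Delta'(T_1)\}+1=\Delta'(T_1\Box T_2)+1.$$
   Context: $\Delta(G)$ is the maximum degree of $G$. For an edge $uv$ of $G$ its edge degree is $d'(u,v)=d(u)+d(v)-1$ (the number of edges incident to $u$ or $v$), and $\Delta'(G)$ is the maximum edge degree over all edges of $G$. The Cartesian product $G\Box H$ has vertex set $V(G)\times V(H)$, with $(a,u)\sim(b,v)$ iff either $a=b$ and $uv\in E(H)$, or $u=v$ and $ab\in E(G)$. A strong edge coloring is a proper edge coloring in which every color class is an induced matching; $\chi_s'(G)$ is the minimum number of colors in such a coloring. -}

module Defs where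

open import Data.Nat using (ℕ; zero; suc; _+_; _*_; _∸_; _⊔_; _≤_)
open import Data.Fin using (Fin; remQuot) renaming (_≟_ to _≟F_)
open import Data.Bool using (Bool; true; false; _∧_; _∨_; if_then_else_; T)
open import Data.List using (List; []; _∷_; _++_; [_]; length; map; foldr; allFin; concatMap)
open import Data.Nat.ListAction using (sum)
open import Data.List.Relation.Unary.Unique.Propositional using (Unique)
open import Data.Product using (Σ; ∃; _×_; _,_; proj₁; proj₂)
open import Data.Sum using (_⊎_)
open import Data.Unit using (⊤)
open import Relation.Nullary using (¬_)
open import Relation.Nullary.Decidable using (⌊_⌋)
open import Relation.Binary.PropositionalEquality using (_≡_)

Adj : ℕ → Set
Adj n = Fin n → Fin n → Bool

record SimpleGraph : Set where
  field
    n      : ℕ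
    adj    : Adj n
    sym    : ∀ u v → adj u v ≡ adj v u
    irrefl : ∀ v → adj v v ≡ false
open SimpleGraph public

deg : ∀ {n} → Adj n → Fin n → ℕ
deg {n} a v = sum (map (λ w → if a v w then 1 else 0) (allFin n))

maxList : List ℕ → ℕ
maxList = foldr _⊔_ 0

Δ : ∀ {n} → Adj n → ℕ
Δ {n} a = maxList (map (deg a) (allFin n))

edgeDeg : ∀ {n} → Adj n → Fin n → Fin n → ℕ
edgeDeg a u v = deg a u + deg a v ∸ 1

Δ' : ∀ {n} → Adj n → ℕ
Δ' {n} a = maxList (concatMap (λ u → map (λ v → if a u v then edgeDeg a u v else 0) (allFin n)) (allFin n))

_□_ : ∀ {m k} → Adj m → Adj k → Adj (m * k)
_□_ {m} {k} g h i j with remQuot {m} k i | remQuot {m} k j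
... | (a , u) | (b , v) = (⌊ a ≟F b ⌋ ∧ h u v) ∨ (⌊ u ≟F v ⌋ ∧ g a b)

data Walk {n} (a : Adj n) : Fin n → Fin n → Set where
  here : ∀ {u} → Walk a u u
  step : ∀ {u w v} → T (a u w) → Walk a w v → Walk a u v

IsWalk : ∀ {n} → Adj n → List (Fin n) → Set
IsWalk a []            = ⊤
IsWalk a (x ∷ [])      = ⊤
IsWalk a (x ∷ y ∷ xs)  = T (a x y) × IsWalk a (y ∷ xs)

Connected : ∀ {n} → Adj n → Set
Connected {n} a = ∀ (u v : Fin n) → Walk a u v

HasCycle : ∀ {n} → Adj n → Set
HasCycle {n} a = Σ (Fin n) λ v → Σ (List (Fin n)) λ rest →
  2 ≤ length rest × Unique (v ∷ rest) × IsWalk a (v ∷ rest ++ [ v ])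

IsTree : SimpleGraph → Set
IsTree G = Connected (adj G) × ¬ HasCycle (adj G)

HasEdge : SimpleGraph → Set
HasEdge G = Σ (Fin (n G)) λ u → Σ (Fin (n G)) λ v → T (adj G u v)

-- Strong edge coloring with colours Fin k: c is a colour for each edge (symmetric
-- on edges), and two edges of the same colour are either equal or at distance ≥ 2
-- (no shared endpoint and no edge joining them), i.e. each colour class is an
-- induced matching.
IsStrongEdgeColoring : ∀ {n} → Adj n → (k : ℕ) → (Fin n → Fin n → Fin k) → Set
IsStrongEdgeColoring a k c =
  (∀ u v → T (a u v) → c u v ≡ c v u) ×
  (∀ u v x y → T (a u v) → T (a x y) → c u v ≡ c x y → (u ≡ x ⊎ T (a u x)) →
     (u ≡ x × v ≡ y) ⊎ (u ≡ y × v ≡ x))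

χs'-≥ : ∀ {n} → Adj n → ℕ → Set
χs'-≥ {n} a m = ∀ k (c : Fin n → Fin n → Fin k) → IsStrongEdgeColoring a k c → m ≤ k

-- A strong edge coloring gives distinct colors to all edges at x or y together with the
-- opposite edge x′y′ of any 4-cycle x y y′ x′ (it replaces yx, already counted at x), so an
-- edge on a 4-cycle forces d(x) + d(y) = d'(x,y) + 1 colors. In G □ H every edge lies on a
-- 4-cycle when neither factor has an isolated vertex, and d(a,u) = d(a) + d(u), so the edge
-- (a,u)(a,v) has edge degree 2 d(a) + d'(u,v) and (a,u)(b,u) has 2 d(u) + d'(a,b); maximising
-- gives Δ'(G □ H) = max{2Δ(G) + Δ'(H), 2Δ(H) + Δ'(G)}.
module Submission where

open import Defs renaming (sym to adj-sym; irrefl to adj-irrefl)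
open import Data.Nat using (ℕ; zero; suc; _+_; _*_; _∸_; _⊔_; _≤_; z≤n; s≤s)
open import Data.Nat.Properties
open import Data.Fin using (Fin; combine; _↑ˡ_; _↑ʳ_; splitAt; join) renaming (_≟_ to _≟F_)
open import Data.Fin.Properties
  using (injective⇒≤; join-splitAt; remQuot-combine; combine-remQuot; combine-injectiveˡ; combine-injectiveʳ)
  renaming (suc-injective to Fin-suc-injective)
open import Data.Bool using (Bool; true; false; _∧_; _∨_; if_then_else_; T)
open import Data.Bool.Properties using (T-∧; T-∨)
open import Function.Bundles using (Equivalence)
open import Data.List using (List; []; _∷_; map; allFin; tabulate; concatMap)
open import Data.List.Membership.Propositional using (_∈_; lose)
open import Data.List.Membership.Propositional.Properties
  using (∈-map⁺; ∈-map⁻; ∈-concatMap⁺; ∈-concatMap⁻; ∈-allFin; foldr-selective)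
open import Data.List.Relation.Unary.Any using (here; there; satisfied)
open import Data.Product using (∃; ∃₂; _×_; _,_; proj₁; proj₂)
open import Data.Sum using (_⊎_; inj₁; inj₂)
open import Data.List.Properties using (map-tabulate)
import Data.Nat.ListAction as ListAction
open import Data.Empty using (⊥; ⊥-elim)
open import Relation.Nullary using (¬_; yes; no)
open import Relation.Nullary.Decidable using (⌊_⌋; ⌊⌋-map′; toWitness; fromWitness)
open import Relation.Binary.PropositionalEquality
open import Data.Nat.Tactic.RingSolver using (solve-∀)
open import Function using (_∘_; id)
open import Function.Definitions using (Injective)
open import Algebra.Properties.CommutativeMonoid.Sum +-0-commutativeMonoid
  using (sum-syntax; sum-cong-≗; ∑-distrib-+; ∑-comm; sum-replicate-zero)

sum-tabulate : ∀ n (f : Fin n → ℕ) → ListAction.sum (tabulate f) ≡ ∑[ i < n ] f i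
sum-tabulate zero    f = refl
sum-tabulate (suc n) f = cong (f Fin.zero +_) (sum-tabulate n (f ∘ Fin.suc))

sum-map-allFin : ∀ n (f : Fin n → ℕ) → ListAction.sum (map f (allFin n)) ≡ ∑[ i < n ] f i
sum-map-allFin n f = trans (cong ListAction.sum (map-tabulate id f)) (sum-tabulate n f)

∑-↑ : ∀ m {n} (f : Fin (m + n) → ℕ) →
      ∑[ i < m + n ] f i ≡ ∑[ i < m ] f (i ↑ˡ n) + ∑[ j < n ] f (m ↑ʳ j)
∑-↑ zero    f = refl
∑-↑ (suc m) f = trans (cong (f Fin.zero +_) (∑-↑ m (f ∘ Fin.suc))) (sym (+-assoc (f Fin.zero) _ _))

∑-combine : ∀ m n (f : Fin (m * n) → ℕ) →
            ∑[ i < m * n ] f i ≡ ∑[ a < m ] ∑[ u < n ] f (combine a u)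
∑-combine zero    n f = refl
∑-combine (suc m) n f =
  trans (∑-↑ n f) (cong (∑[ u < n ] f (combine {suc m} Fin.zero u) +_) (∑-combine m n (f ∘ (n ↑ʳ_))))

indicator : Bool → ℕ
indicator b = if b then 1 else 0

indicator-∨ : ∀ x y → (T x → T y → ⊥) → indicator (x ∨ y) ≡ indicator x + indicator y
indicator-∨ true  true  disjoint = ⊥-elim (disjoint _ _)
indicator-∨ true  false disjoint = refl
indicator-∨ false y     disjoint = refl

∑-indicator-≟∧ : ∀ {n} (i : Fin n) (p : Fin n → Bool) →
                 ∑[ j < n ] indicator (⌊ i ≟F j ⌋ ∧ p j) ≡ indicator (p i)
∑-indicator-≟∧ {suc n} Fin.zero    p =
  trans (cong (indicator (p Fin.zero) +_) (sum-replicate-zero n)) (+-identityʳ _)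
-- ⌊ suc i ≟ suc j ⌋ does not reduce to ⌊ i ≟ j ⌋, as ⌊_⌋ is strict in the decision.
∑-indicator-≟∧ {suc n} (Fin.suc i) p =
  trans (sum-cong-≗ (λ j → cong (λ b → indicator (b ∧ p (Fin.suc j))) (⌊⌋-map′ _ _ (i ≟F j))))
        (∑-indicator-≟∧ i (p ∘ Fin.suc))

≤-∑ : ∀ {n} (f : Fin n → ℕ) i → f i ≤ ∑[ j < n ] f j
≤-∑ f Fin.zero    = m≤m+n _ _
≤-∑ f (Fin.suc i) = ≤-trans (≤-∑ (f ∘ Fin.suc) i) (m≤n+m _ (f Fin.zero))

≤-maxList : ∀ {x xs} → x ∈ xs → x ≤ maxList xs
≤-maxList (here refl)               = m≤m⊔n _ _
≤-maxList {xs = y ∷ _} (there x∈xs) = ≤-trans (≤-maxList x∈xs) (m≤n⊔m y _)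

maxList-≤ : ∀ {b} xs → (∀ {x} → x ∈ xs → x ≤ b) → maxList xs ≤ b
maxList-≤ []       bound = z≤n
maxList-≤ (x ∷ xs) bound = ⊔-lub (bound (here refl)) (maxList-≤ xs (bound ∘ there))

maxList-sel : ∀ xs → maxList xs ≡ 0 ⊎ maxList xs ∈ xs
maxList-sel = foldr-selective ⊔-sel 0

module _ {n} (a : Adj n) where

  deg≡∑ : ∀ v → deg a v ≡ ∑[ w < n ] indicator (a v w)
  deg≡∑ v = sum-map-allFin n (indicator ∘ a v)

  adj⇒1≤deg : ∀ {u v} → T (a u v) → 1 ≤ deg a u
  adj⇒1≤deg {u} {v} u~v =
    subst (1 ≤_) (sym (deg≡∑ u)) (≤-trans (indicator-T u~v) (≤-∑ (indicator ∘ a u) v))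
    where
    indicator-T : ∀ {b} → T b → 1 ≤ indicator b
    indicator-T {true} _ = ≤-refl

  deg≤Δ : ∀ v → deg a v ≤ Δ a
  deg≤Δ v = ≤-maxList (∈-map⁺ (deg a) (∈-allFin v))

  Δ-attained : Fin n → ∃ λ v → Δ a ≤ deg a v
  Δ-attained v with maxList-sel (map (deg a) (allFin n))
  ... | inj₁ Δ≡0 = v , subst (_≤ deg a v) (sym Δ≡0) z≤n
  ... | inj₂ Δ∈  with ∈-map⁻ (deg a) Δ∈
  ...   | w , _ , Δ≡ = w , ≤-reflexive Δ≡

  adjEdgeDeg : Fin n → Fin n → ℕ
  adjEdgeDeg u v = if a u v then edgeDeg a u v else 0

  adjEdgeDeg-≤ : ∀ {b} u v → (T (a u v) → edgeDeg a u v ≤ b) → adjEdgeDeg u v ≤ b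
  adjEdgeDeg-≤ u v bound with a u v
  ... | true  = bound _
  ... | false = z≤n

  adjEdgeDeg-T : ∀ u v → T (a u v) → adjEdgeDeg u v ≡ edgeDeg a u v
  adjEdgeDeg-T u v u~v with a u v
  ... | true = refl

  adjEdgeDeg-cases : ∀ u v → (T (a u v) × adjEdgeDeg u v ≡ edgeDeg a u v) ⊎ adjEdgeDeg u v ≡ 0
  adjEdgeDeg-cases u v with a u v
  ... | true  = inj₁ (_ , refl)
  ... | false = inj₂ refl

  edgeDegsAt : Fin n → List ℕ
  edgeDegsAt u = map (adjEdgeDeg u) (allFin n)

  edgeDegs : List ℕ
  edgeDegs = concatMap edgeDegsAt (allFin n)

  ∈-edgeDegs⁺ : ∀ {u v} → T (a u v) → edgeDeg a u v ∈ edgeDegs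
  ∈-edgeDegs⁺ {u} {v} u~v =
    ∈-concatMap⁺ edgeDegsAt
      (lose (∈-allFin u) (subst (_∈ _) (adjEdgeDeg-T u v u~v) (∈-map⁺ (adjEdgeDeg u) (∈-allFin v))))

  ∈-edgeDegs⁻ : ∀ {x} → x ∈ edgeDegs → ∃₂ λ u v → x ≡ adjEdgeDeg u v
  ∈-edgeDegs⁻ x∈ with satisfied (∈-concatMap⁻ edgeDegsAt {xs = allFin n} x∈)
  ... | u , x∈edgeDegsAt with ∈-map⁻ (adjEdgeDeg u) x∈edgeDegsAt
  ...   | v , _ , x≡ = u , v , x≡

  edgeDeg≤Δ' : ∀ {u v} → T (a u v) → edgeDeg a u v ≤ Δ' a
  edgeDeg≤Δ' u~v = ≤-maxList (∈-edgeDegs⁺ u~v)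

  Δ'-≤ : ∀ {b} → (∀ u v → T (a u v) → edgeDeg a u v ≤ b) → Δ' a ≤ b
  Δ'-≤ {b} bound = maxList-≤ edgeDegs λ x∈ → entry≤ (∈-edgeDegs⁻ x∈)
    where
    entry≤ : ∀ {x} → ∃₂ (λ u v → x ≡ adjEdgeDeg u v) → x ≤ b
    entry≤ (u , v , refl) = adjEdgeDeg-≤ u v (bound u v)

  Δ'-attained : ∀ {u v} → T (a u v) → ∃₂ λ u′ v′ → T (a u′ v′) × Δ' a ≤ edgeDeg a u′ v′
  Δ'-attained {u} {v} u~v with maxList-sel edgeDegs
  ... | inj₁ Δ'≡0 = u , v , u~v , subst (_≤ edgeDeg a u v) (sym Δ'≡0) z≤n
  ... | inj₂ Δ'∈  with ∈-edgeDegs⁻ Δ'∈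
  ...   | u′ , v′ , Δ'≡ with adjEdgeDeg-cases u′ v′
  ...     | inj₁ (u′~v′ , e) = u′ , v′ , u′~v′ , ≤-reflexive (trans Δ'≡ e)
  ...     | inj₂ e          = u , v , u~v , subst (_≤ edgeDeg a u v) (sym (trans Δ'≡ e)) z≤n

injective⇒+≤ : ∀ {m n k} {f : Fin m ⊎ Fin n → Fin k} → Injective _≡_ _≡_ f → m + n ≤ k
injective⇒+≤ {m} {n} {f = f} f-inj = injective⇒≤ {f = f ∘ splitAt m} λ {i} {j} fi≡fj →
  trans (sym (join-splitAt m n i)) (trans (cong (join m n) (f-inj fi≡fj)) (join-splitAt m n j))

record Enumeration {n} (p : Fin n → Bool) (size : ℕ) : Set where
  field
    element           : Fin size → Fin n
    element-injective : Injective _≡_ _≡_ element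
    element-satisfies : ∀ i → T (p (element i))

enumerate : ∀ {n} (p : Fin n → Bool) → Enumeration p (∑[ i < n ] indicator (p i))
enumerate {zero}  p = record { element = λ () ; element-injective = λ {} ; element-satisfies = λ () }
enumerate {suc n} p with p Fin.zero in p0 | enumerate (p ∘ Fin.suc)
... | false | record { element = e ; element-injective = e-inj ; element-satisfies = e-sat } =
  record { element = Fin.suc ∘ e ; element-injective = e-inj ∘ Fin-suc-injective ; element-satisfies = e-sat }
... | true  | record { element = e ; element-injective = e-inj ; element-satisfies = e-sat } =
  record { element = e′ ; element-injective = e′-inj ; element-satisfies = e′-sat }
  where
  e′ : Fin (suc _) → Fin (suc n)
  e′ Fin.zero    = Fin.zero
  e′ (Fin.suc i) = Fin.suc (e i)
  e′-inj : Injective _≡_ _≡_ e′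
  e′-inj {Fin.zero}  {Fin.zero}  _  = refl
  e′-inj {Fin.zero}  {Fin.suc _} ()
  e′-inj {Fin.suc _} {Fin.zero}  ()
  e′-inj {Fin.suc i} {Fin.suc j} eq = cong Fin.suc (e-inj (Fin-suc-injective eq))
  e′-sat : ∀ i → T (p (e′ i))
  e′-sat Fin.zero    = subst T (sym p0) _
  e′-sat (Fin.suc i) = e-sat i

loopless : ∀ G {u v} → u ≡ v → ¬ T (adj G u v)
loopless G {u} refl = subst T (adj-irrefl G u)

record Square {n} (a : Adj n) (x y : Fin n) : Set where
  field
    x′ y′ : Fin n
    x~x′  : T (a x x′)
    y~y′  : T (a y y′)
    x′~y′ : T (a x′ y′)
    x′≢y  : x′ ≢ y
    y′≢x  : y′ ≢ x

module StrongEdgeColoring (G : SimpleGraph) {k} {c : Fin (n G) → Fin (n G) → Fin k}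
                          (strong : IsStrongEdgeColoring (adj G) k c) where

  private
    a : Adj (n G)
    a = adj G

  color-injective : ∀ {u v w} → T (a u v) → T (a u w) → c u v ≡ c u w → v ≡ w
  color-injective u~v u~w eq with proj₂ strong _ _ _ _ u~v u~w eq (inj₁ refl)
  ... | inj₁ (_ , v≡w) = v≡w
  ... | inj₂ (u≡w , _) = ⊥-elim (loopless G u≡w u~w)

  color-adjacent : ∀ {u v u′ v′} → T (a u v) → T (a u′ v′) → T (a u u′) → c u v ≡ c u′ v′ → u ≡ v′
  color-adjacent u~v u′~v′ u~u′ eq with proj₂ strong _ _ _ _ u~v u′~v′ eq (inj₂ u~u′)
  ... | inj₁ (u≡u′ , _) = ⊥-elim (loopless G u≡u′ u~u′)
  ... | inj₂ (u≡v′ , _) = u≡v′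

  deg+deg≤colors : ∀ {x y} → T (a x y) → Square a x y → deg a x + deg a y ≤ k
  deg+deg≤colors {x} {y} x~y sq =
    subst (_≤ k) (sym (cong₂ _+_ (deg≡∑ a x) (deg≡∑ a y)))
      (injective⇒+≤ {f = colorOf} colorOf-injective)
    where
    open Square sq
    open Enumeration (enumerate (a x))
      renaming (element to nx; element-injective to nx-injective; element-satisfies to x~nx)
    open Enumeration (enumerate (a y))
      renaming (element to ny; element-injective to ny-injective; element-satisfies to y~ny)

    -- The edge yx is already colored at x; the edge x′y′ takes its place.
    colorAtY : Fin (n G) → Fin k
    colorAtY z with z ≟F x
    ... | yes _ = c x′ y′
    ... | no  _ = c y z

    colorOf : Fin _ ⊎ Fin _ → Fin k
    colorOf (inj₁ i) = c x (nx i)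
    colorOf (inj₂ j) = colorAtY (ny j)

    y-vs-x′y′ : ∀ {z} → T (a y z) → z ≢ x → c y z ≢ c x′ y′
    y-vs-x′y′ y~z z≢x eq =
      x′≢y (sym (color-adjacent y~z y′~x′ y~y′ (trans eq (proj₁ strong _ _ x′~y′))))
      where
      y′~x′ : T (a y′ x′)
      y′~x′ = subst T (adj-sym G x′ y′) x′~y′

    x-vs-y : ∀ i j → colorOf (inj₁ i) ≢ colorOf (inj₂ j)
    x-vs-y i j eq with ny j ≟F x | y~ny j
    ... | yes _   | _    = y′≢x (sym (color-adjacent (x~nx i) x′~y′ x~x′ eq))
    ... | no z≢x  | y~z  = z≢x (sym (color-adjacent (x~nx i) y~z x~y eq))

    colorOf-injective : Injective _≡_ _≡_ colorOf
    colorOf-injective {inj₁ i} {inj₁ j} eq =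
      cong inj₁ (nx-injective (color-injective (x~nx i) (x~nx j) eq))
    colorOf-injective {inj₁ i} {inj₂ j} eq = ⊥-elim (x-vs-y i j eq)
    colorOf-injective {inj₂ i} {inj₁ j} eq = ⊥-elim (x-vs-y j i (sym eq))
    colorOf-injective {inj₂ i} {inj₂ j} eq with ny i ≟F x | ny j ≟F x | y~ny i | y~ny j
    ... | yes i≡x | yes j≡x | _   | _   = cong inj₂ (ny-injective (trans i≡x (sym j≡x)))
    ... | yes _   | no z≢x  | _   | y~z = ⊥-elim (y-vs-x′y′ y~z z≢x (sym eq))
    ... | no z≢x  | yes _   | y~z | _   = ⊥-elim (y-vs-x′y′ y~z z≢x eq)
    ... | no _    | no _    | y~i | y~j = cong inj₂ (ny-injective (color-injective y~i y~j eq))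

  suc-Δ'≤colors : (∀ {x y} → T (a x y) → Square a x y) → HasEdge G → suc (Δ' a) ≤ k
  suc-Δ'≤colors square (u , v , u~v) with Δ'-attained a u~v
  ... | x , y , x~y , Δ'≤ =
    ≤-trans (s≤s Δ'≤) (subst (_≤ k) (sym (m+[n∸m]≡n 1≤)) (deg+deg≤colors x~y (square x~y)))
    where
    1≤ : 1 ≤ deg a x + deg a y
    1≤ = ≤-trans (adj⇒1≤deg a x~y) (m≤m+n _ _)

χs'-≥-suc-Δ' : ∀ G → (∀ {x y} → T (adj G x y) → Square (adj G) x y) → HasEdge G →
               χs'-≥ (adj G) (suc (Δ' (adj G)))
χs'-≥-suc-Δ' G square e k c strong = StrongEdgeColoring.suc-Δ'≤colors G strong square e

T-ext : ∀ {x y} → (T x → T y) → (T y → T x) → x ≡ y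
T-ext {false} {false} _   _   = refl
T-ext {false} {true}  _   y⇒x = ⊥-elim (y⇒x _)
T-ext {true}  {false} x⇒y _   = ⊥-elim (x⇒y _)
T-ext {true}  {true}  _   _   = refl

data CombineView {m k} : Fin (m * k) → Set where
  combine⁺ : (a : Fin m) (u : Fin k) → CombineView (combine a u)

combineView : ∀ {m k} i → CombineView {m} {k} i
combineView {m} {k} i = subst (CombineView {m} {k}) (combine-remQuot {m} k i) (combine⁺ _ _)

module _ {m k} (g : Adj m) (h : Adj k) where

  □-combine : ∀ a u b v →
              (g □ h) (combine a u) (combine b v) ≡ (⌊ a ≟F b ⌋ ∧ h u v) ∨ (⌊ u ≟F v ⌋ ∧ g a b)
  □-combine a u b v = cong₂ adjPairs (remQuot-combine {m} {k} a u) (remQuot-combine {m} {k} b v)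
    where
    adjPairs : Fin m × Fin k → Fin m × Fin k → Bool
    adjPairs (a , u) (b , v) = (⌊ a ≟F b ⌋ ∧ h u v) ∨ (⌊ u ≟F v ⌋ ∧ g a b)

  □-edge⁻ : ∀ {a u b v} → T ((g □ h) (combine a u) (combine b v)) →
            (a ≡ b × T (h u v)) ⊎ (u ≡ v × T (g a b))
  □-edge⁻ {a} {u} {b} {v} e with Equivalence.to (T-∨ {⌊ a ≟F b ⌋ ∧ h u v}) (subst T (□-combine a u b v) e)
  ... | inj₁ horizontal = let a≡b , h~ = Equivalence.to (T-∧ {⌊ a ≟F b ⌋}) horizontal
                          in inj₁ (toWitness a≡b , h~)
  ... | inj₂ vertical   = let u≡v , g~ = Equivalence.to (T-∧ {⌊ u ≟F v ⌋}) vertical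
                          in inj₂ (toWitness u≡v , g~)

  □-edgeʰ : ∀ {a u v} → T (h u v) → T ((g □ h) (combine a u) (combine a v))
  □-edgeʰ {a} {u} {v} h~ =
    subst T (sym (□-combine a u a v)) (Equivalence.from (T-∨ {⌊ a ≟F a ⌋ ∧ h u v})
      (inj₁ (Equivalence.from (T-∧ {⌊ a ≟F a ⌋}) (fromWitness refl , h~))))

  □-edgeᵛ : ∀ {a b u} → T (g a b) → T ((g □ h) (combine a u) (combine b u))
  □-edgeᵛ {a} {b} {u} g~ =
    subst T (sym (□-combine a u b u)) (Equivalence.from (T-∨ {⌊ a ≟F b ⌋ ∧ h u u})
      (inj₂ (Equivalence.from (T-∧ {⌊ u ≟F u ⌋}) (fromWitness refl , g~))))

[m+n]+[m+o]∸1≡2*m+[n+o∸1] : ∀ m n o → 1 ≤ n + o → (m + n) + (m + o) ∸ 1 ≡ 2 * m + (n + o ∸ 1)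
[m+n]+[m+o]∸1≡2*m+[n+o∸1] m n o 1≤n+o =
  trans (cong (_∸ 1) (regroup m n o)) (+-∸-assoc (2 * m) 1≤n+o)
  where
  regroup : ∀ m n o → (m + n) + (m + o) ≡ 2 * m + (n + o)
  regroup = solve-∀

module _ (G H : SimpleGraph) where

  private
    g : Adj (n G)
    g = adj G
    h : Adj (n H)
    h = adj H

  □-flip : ∀ {i j} → T ((g □ h) i j) → T ((g □ h) j i)
  □-flip {i} {j} e with combineView {n G} {n H} i | combineView {n G} {n H} j
  ... | combine⁺ a u | combine⁺ b v with □-edge⁻ g h e
  ...   | inj₁ (refl , h~) = □-edgeʰ g h (subst T (adj-sym H u v) h~)
  ...   | inj₂ (refl , g~) = □-edgeᵛ g h (subst T (adj-sym G a b) g~)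

  □-loopless : ∀ i → ¬ T ((g □ h) i i)
  □-loopless i e with combineView {n G} {n H} i
  ... | combine⁺ a u with □-edge⁻ g h e
  ...   | inj₁ (_ , h~) = subst T (adj-irrefl H u) h~
  ...   | inj₂ (_ , g~) = subst T (adj-irrefl G a) g~

  deg-□ : ∀ a u → deg (g □ h) (combine a u) ≡ deg g a + deg h u
  deg-□ a u = begin
      deg (g □ h) (combine a u)
    ≡⟨ deg≡∑ (g □ h) (combine a u) ⟩
      ∑[ j < n G * n H ] indicator ((g □ h) (combine a u) j)
    ≡⟨ ∑-combine (n G) (n H) _ ⟩
      ∑[ b < n G ] ∑[ v < n H ] indicator ((g □ h) (combine a u) (combine b v))
    ≡⟨ sum-cong-≗ (λ b → sum-cong-≗ (split b)) ⟩
      ∑[ b < n G ] ∑[ v < n H ] (horizontal b v + vertical b v)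
    ≡⟨ sum-cong-≗ (λ b → ∑-distrib-+ (horizontal b) (vertical b)) ⟩
      ∑[ b < n G ] (∑[ v < n H ] horizontal b v + ∑[ v < n H ] vertical b v)
    ≡⟨ ∑-distrib-+ (λ b → ∑[ v < n H ] horizontal b v) (λ b → ∑[ v < n H ] vertical b v) ⟩
      ∑[ b < n G ] ∑[ v < n H ] horizontal b v + ∑[ b < n G ] ∑[ v < n H ] vertical b v
    ≡⟨ cong₂ _+_ (trans (∑-comm horizontal) (sum-cong-≗ λ v → ∑-indicator-≟∧ a (λ _ → h u v)))
                 (sum-cong-≗ λ b → ∑-indicator-≟∧ u (λ _ → g a b)) ⟩
      ∑[ v < n H ] indicator (h u v) + ∑[ b < n G ] indicator (g a b)
    ≡⟨ cong₂ _+_ (sym (deg≡∑ h u)) (sym (deg≡∑ g a)) ⟩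
      deg h u + deg g a
    ≡⟨ +-comm (deg h u) (deg g a) ⟩
      deg g a + deg h u
    ∎
    where
    open ≡-Reasoning
    horizontal vertical : Fin (n G) → Fin (n H) → ℕ
    horizontal b v = indicator (⌊ a ≟F b ⌋ ∧ h u v)
    vertical   b v = indicator (⌊ u ≟F v ⌋ ∧ g a b)

    split : ∀ b v → indicator ((g □ h) (combine a u) (combine b v)) ≡ horizontal b v + vertical b v
    split b v = trans (cong indicator (□-combine g h a u b v)) (indicator-∨ _ _ λ hor ver →
      loopless H (toWitness (proj₁ (Equivalence.to (T-∧ {⌊ u ≟F v ⌋}) ver)))
                 (proj₂ (Equivalence.to (T-∧ {⌊ a ≟F b ⌋}) hor)))

  edgeDeg-□ʰ : ∀ {a u v} → T (h u v) →
               edgeDeg (g □ h) (combine a u) (combine a v) ≡ 2 * deg g a + edgeDeg h u v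
  edgeDeg-□ʰ {a} {u} {v} h~ =
    trans (cong₂ (λ s t → s + t ∸ 1) (deg-□ a u) (deg-□ a v))
          ([m+n]+[m+o]∸1≡2*m+[n+o∸1] (deg g a) (deg h u) (deg h v)
             (≤-trans (adj⇒1≤deg h h~) (m≤m+n _ _)))

  edgeDeg-□ᵛ : ∀ {a b u} → T (g a b) →
               edgeDeg (g □ h) (combine a u) (combine b u) ≡ 2 * deg h u + edgeDeg g a b
  edgeDeg-□ᵛ {a} {b} {u} g~ =
    trans (cong₂ (λ s t → s + t ∸ 1) (trans (deg-□ a u) (+-comm (deg g a) _))
                                     (trans (deg-□ b u) (+-comm (deg g b) _)))
          ([m+n]+[m+o]∸1≡2*m+[n+o∸1] (deg h u) (deg g a) (deg g b)
             (≤-trans (adj⇒1≤deg g g~) (m≤m+n _ _)))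

  Δ'-□ : HasEdge G → HasEdge H → Δ' (g □ h) ≡ (2 * Δ g + Δ' h) ⊔ (2 * Δ h + Δ' g)
  Δ'-□ (a₀ , _ , g~₀) (u₀ , _ , h~₀) =
    ≤-antisym (Δ'-≤ (g □ h) edgeDeg≤) (⊔-lub horizontal vertical)
    where
    bound : ℕ
    bound = (2 * Δ g + Δ' h) ⊔ (2 * Δ h + Δ' g)

    edgeDeg≤ : ∀ i j → T ((g □ h) i j) → edgeDeg (g □ h) i j ≤ bound
    edgeDeg≤ i j e with combineView {n G} {n H} i | combineView {n G} {n H} j
    ... | combine⁺ a u | combine⁺ b v with □-edge⁻ g h e
    ...   | inj₁ (refl , h~) = subst (_≤ bound) (sym (edgeDeg-□ʰ h~))
            (≤-trans (+-mono-≤ (*-monoʳ-≤ 2 (deg≤Δ g a)) (edgeDeg≤Δ' h h~))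
                     (m≤m⊔n (2 * Δ g + Δ' h) _))
    ...   | inj₂ (refl , g~) = subst (_≤ bound) (sym (edgeDeg-□ᵛ g~))
            (≤-trans (+-mono-≤ (*-monoʳ-≤ 2 (deg≤Δ h u)) (edgeDeg≤Δ' g g~))
                     (m≤n⊔m _ (2 * Δ h + Δ' g)))

    horizontal : 2 * Δ g + Δ' h ≤ Δ' (g □ h)
    horizontal with Δ-attained g a₀ | Δ'-attained h h~₀
    ... | a , Δ≤ | u , v , h~ , Δ'≤ = ≤-trans (+-mono-≤ (*-monoʳ-≤ 2 Δ≤) Δ'≤)
          (subst (_≤ Δ' (g □ h)) (edgeDeg-□ʰ h~) (edgeDeg≤Δ' (g □ h) (□-edgeʰ g h h~)))

    vertical : 2 * Δ h + Δ' g ≤ Δ' (g □ h)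
    vertical with Δ-attained h u₀ | Δ'-attained g g~₀
    ... | u , Δ≤ | a , b , g~ , Δ'≤ = ≤-trans (+-mono-≤ (*-monoʳ-≤ 2 Δ≤) Δ'≤)
          (subst (_≤ Δ' (g □ h)) (edgeDeg-□ᵛ g~) (edgeDeg≤Δ' (g □ h) (□-edgeᵛ g h g~)))

  □-square : (∀ a → ∃ (T ∘ g a)) → (∀ u → ∃ (T ∘ h u)) →
             ∀ {i j} → T ((g □ h) i j) → Square (g □ h) i j
  □-square g-neighbour h-neighbour {i} {j} e with combineView {n G} {n H} i | combineView {n G} {n H} j
  ... | combine⁺ a u | combine⁺ b v with □-edge⁻ g h e
  ...   | inj₁ (refl , h~) = let a′ , g~ = g-neighbour a in record
          { x′ = combine a′ u ; y′ = combine a′ v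
          ; x~x′ = □-edgeᵛ g h g~ ; y~y′ = □-edgeᵛ g h g~ ; x′~y′ = □-edgeʰ g h h~
          ; x′≢y = λ eq → loopless G (sym (combine-injectiveˡ a′ u a v eq)) g~
          ; y′≢x = λ eq → loopless G (sym (combine-injectiveˡ a′ v a u eq)) g~
          }
  ...   | inj₂ (refl , g~) = let u′ , h~ = h-neighbour u in record
          { x′ = combine a u′ ; y′ = combine b u′
          ; x~x′ = □-edgeʰ g h h~ ; y~y′ = □-edgeʰ g h h~ ; x′~y′ = □-edgeᵛ g h g~
          ; x′≢y = λ eq → loopless H (sym (combine-injectiveʳ a u′ b u eq)) h~
          ; y′≢x = λ eq → loopless H (sym (combine-injectiveʳ b u′ a u eq)) h~
          }

_□ᴳ_ : SimpleGraph → SimpleGraph → SimpleGraph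
G □ᴳ H = record
  { n      = n G * n H
  ; adj    = adj G □ adj H
  ; sym    = λ i j → T-ext (□-flip G H) (□-flip G H)
  ; irrefl = λ i → T-ext (⊥-elim ∘ □-loopless G H i) λ ()
  }

connected⇒neighbour : ∀ G → Connected (adj G) → HasEdge G → ∀ v → ∃ (T ∘ adj G v)
connected⇒neighbour G connected (x , y , x~y) v with connected v x
... | here       = y , x~y
... | step v~w _ = _ , v~w

theorem5 : (T₁ T₂ : SimpleGraph) → IsTree T₁ → IsTree T₂ → HasEdge T₁ → HasEdge T₂ →
    χs'-≥ (adj T₁ □ adj T₂) (suc ((2 * Δ (adj T₁) + Δ' (adj T₂)) ⊔ (2 * Δ (adj T₂) + Δ' (adj T₁))))
    × suc ((2 * Δ (adj T₁) + Δ' (adj T₂)) ⊔ (2 * Δ (adj T₂) + Δ' (adj T₁))) ≡ suc (Δ' (adj T₁ □ adj T₂))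
theorem5 T₁ T₂ (connected₁ , _) (connected₂ , _) e₁@(a , b , a~b) e₂@(u , _ , _) =
  subst (χs'-≥ (adj T₁ □ adj T₂)) (cong suc Δ'-product) χs'-≥-suc-Δ'-product ,
  cong suc (sym Δ'-product)
  where
  Δ'-product : Δ' (adj T₁ □ adj T₂) ≡ (2 * Δ (adj T₁) + Δ' (adj T₂)) ⊔ (2 * Δ (adj T₂) + Δ' (adj T₁))
  Δ'-product = Δ'-□ T₁ T₂ e₁ e₂

  χs'-≥-suc-Δ'-product : χs'-≥ (adj T₁ □ adj T₂) (suc (Δ' (adj T₁ □ adj T₂)))
  χs'-≥-suc-Δ'-product =
    χs'-≥-suc-Δ' (T₁ □ᴳ T₂)
      (□-square T₁ T₂ (connected⇒neighbour T₁ connected₁ e₁)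
                      (connected⇒neighbour T₂ connected₂ e₂))
      (combine a u , combine b u , □-edgeᵛ (adj T₁) (adj T₂) a~b)
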